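{- For every prime $p$, the sum in $\mathbb{Z}_p$ of the series $\sum_{n=0}^{\infty} p^{v_p(n!)}$ is irrational, i.e. it is not equal to $a/b$ for any integers $a, b$ with $b \neq 0$.
   Context: $\mathbb{Z}_p$ is the ring of $p$-adic integers, and the series converges in $\mathbb{Z}_p$ since $v_p(n!) \to \infty$. For a positive integer $m$, $v_p(m)$ denotes the exponent of the highest power of $p$ dividing $m$. -}

module Defs where

open import Data.Nat using (ℕ; zero; suc; _^_; _!; _≤_; _/_)
open import Data.Nat.Divisibility using (_∣?_)
open import Data.List using (map; upTo)
open import Data.Nat.ListAction using (sum)
open import Data.Integer as ℤ using (ℤ; +_; _-_; _*_)
open import Data.Integer.Divisibility as ℤD using ()
open import Data.Product using (∃)
open import Relation.Nullary using (yes; no)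

-- Computed by repeated division, with fuel m
-- (sufficient since m ≥ p^(v_p(m)) ≥ v_p(m)).  Conventional junk values:
-- v_p(m) = 0 when p < 2 or m = 0 (never used below, since n! ≥ 1).
vpAux : ℕ → ℕ → ℕ → ℕ
vpAux zero q m = 0
vpAux (suc f) q zero = 0
vpAux (suc f) q (suc m) with suc (suc q) ∣? suc m
... | yes _ = suc (vpAux f q (suc m / suc (suc q)))
... | no _ = 0

vp : ℕ → ℕ → ℕ
vp zero m = 0
vp (suc zero) m = 0
vp (suc (suc q)) m = vpAux m q m

partialSum : ℕ → ℕ → ℕ
partialSum p N = sum (map (λ n → p ^ vp p (n !)) (upTo N))

PAdicConvergesTo : ℕ → (ℕ → ℤ) → ℤ → Set
PAdicConvergesTo p s x =
  ∀ (k : ℕ) → ∃ λ (N₀ : ℕ) → ∀ (N : ℕ) → N₀ ≤ N → (+ (p ^ k)) ℤD.∣ (s N - x)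

-- The sum S = Σ_{n≥0} p^{v_p(n!)} ∈ ℤ_p equals a/b (b ≠ 0), i.e. b·S = a in ℤ_p,
-- i.e. the partial sums b·s_N converge p-adically to a.
SeriesSumEq : ℕ → ℤ → ℤ → Set
SeriesSumEq p a b = PAdicConvergesTo p (λ N → b * (+ partialSum p N)) a

-- Write e(n) = v_p(n!) and F(n) = p^e(n).  Two growth facts about e drive the
-- proof: e(n + p) > e(n), which makes the partial sums geometrically dominated,
-- Σ_{n ≤ K} F(n) ≤ 2p F(K); and e(p^m) ≥ e(p^m − 1) + m.  So at N = p^m the
-- partial sum s_N is tiny compared with F(N), while every later term of the series
-- is divisible by F(N).  If b S = a, then b s_N − a is divisible by F(N) yet has
-- absolute value < F(N) once p^m exceeds 2p|b| + |a|; hence b s_N = a for all large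
-- m, which contradicts the strict growth of the partial sums.
module Submission where

open import Data.Integer as ℤ using (ℤ; 0ℤ; +_)
import Data.Integer.Divisibility as ℤD
import Data.Integer.Divisibility.Signed as ℤS
import Data.Integer.Properties as ℤP
import Data.Integer.Tactic.RingSolver as ℤRing
open import Data.List using (map; upTo; _++_; [_])
open import Data.List.Properties using (upTo-∷ʳ; map-++)
open import Data.Nat
open import Data.Nat.Combinatorics using (k![n∸k]!∣n!)
open import Data.Nat.DivMod using (m*[n/m]≡n; m/n<m)
open import Data.Nat.Divisibility
open import Data.Nat.Induction using (<-rec)
open import Data.Nat.ListAction using (sum)
open import Data.Nat.ListAction.Properties using (sum-++)
open import Data.Nat.Primality using (Prime; prime⇒nonTrivial)
open import Data.Nat.Properties
open import Data.Nat.Tactic.RingSolver using (solve-∀)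
open import Data.Product using (_,_; proj₁; proj₂)
open import Function using (_∘_)
open import Relation.Binary.PropositionalEquality hiding ([_])
open import Relation.Nullary using (¬_; yes; no; contradiction)

open import Defs

^-monoʳ-∣ : ∀ m {i j} → i ≤ j → m ^ i ∣ m ^ j
^-monoʳ-∣ m {i} {j} i≤j = divides (m ^ (j ∸ i)) (begin
  m ^ j               ≡⟨ cong (m ^_) (m+[n∸m]≡n i≤j) ⟨
  m ^ (i + (j ∸ i))   ≡⟨ ^-distribˡ-+-* m i (j ∸ i) ⟩
  m ^ i * m ^ (j ∸ i) ≡⟨ *-comm (m ^ i) (m ^ (j ∸ i)) ⟩
  m ^ (j ∸ i) * m ^ i ∎)
  where open ≡-Reasoning

n<m^n : ∀ {m} → 1 < m → ∀ n → n < m ^ n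
n<m^n 1<m zero = s≤s z≤n
n<m^n {m} 1<m (suc n) = begin-strict
  suc n             ≤⟨ n<m^n 1<m n ⟩
  m ^ n             <⟨ m<m+n (m ^ n) (m^n>0 m n) ⟩
  m ^ n + m ^ n     ≡⟨ cong (λ k → m ^ n + k) (+-identityʳ (m ^ n)) ⟨
  2 * m ^ n         ≤⟨ *-monoˡ-≤ (m ^ n) 1<m ⟩
  m * m ^ n         ∎
  where
  open ≤-Reasoning
  instance _ = >-nonZero (<-trans z<s 1<m)

∣∧<⇒≡0 : ∀ {d n} → d ∣ n → n < d → n ≡ 0
∣∧<⇒≡0 {n = zero}  _   _   = refl
∣∧<⇒≡0 {n = suc _} d∣n n<d = contradiction d∣n (>⇒∤ n<d)

limit-attained : ∀ {p s x N} E → PAdicConvergesTo p s x →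
                 (∀ N′ → N ≤ N′ → + (p ^ E) ℤD.∣ (s N′ ℤ.- s N)) →
                 ℤ.∣ s N ℤ.- x ∣ < p ^ E → s N ≡ x
limit-attained {p} {s} {x} {N} E s→x increment∣ close =
  ℤP.i-j≡0⇒i≡j (s N) x (ℤP.∣i∣≡0⇒i≡0 (∣∧<⇒≡0 (ℤS.∣⇒∣ᵤ distance∣) close))
  where
  N′ : ℕ
  N′ = proj₁ (s→x E) + N

  N≤N′ : N ≤ N′
  N≤N′ = m≤n+m N (proj₁ (s→x E))

  difference : ∀ u v w → v ℤ.- w ≡ (u ℤ.- w) ℤ.- (u ℤ.- v)
  difference = ℤRing.solve-∀

  limit∣ : ℤS._∣_ (+ (p ^ E)) (s N′ ℤ.- x)
  limit∣ = ℤS.∣ᵤ⇒∣ (proj₂ (s→x E) N′ (m≤m+n (proj₁ (s→x E)) N))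

  distance∣ : ℤS._∣_ (+ (p ^ E)) (s N ℤ.- x)
  distance∣ = subst (ℤS._∣_ (+ (p ^ E))) (sym (difference (s N′) (s N) x))
    (ℤS.∣m∣n⇒∣m-n limit∣ (ℤS.∣ᵤ⇒∣ {i = s N′ ℤ.- s N} (increment∣ N′ N≤N′)))

∣-*-increment : ∀ b {d x y} → y ≤ x → d ∣ x ∸ y → + d ℤD.∣ (b ℤ.* + x ℤ.- b ℤ.* + y)
∣-*-increment b {d} {x} {y} y≤x d∣x∸y =
  subst (d ∣_) (sym (trans (cong ℤ.∣_∣ increment) (ℤP.abs-* b (+ (x ∸ y))))) (∣n⇒∣m*n ℤ.∣ b ∣ d∣x∸y)
  where
  open ≡-Reasoning
  factor : ∀ b u v → b ℤ.* u ℤ.- b ℤ.* v ≡ b ℤ.* (u ℤ.- v)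
  factor = ℤRing.solve-∀
  increment : b ℤ.* + x ℤ.- b ℤ.* + y ≡ b ℤ.* + (x ∸ y)
  increment = begin
    b ℤ.* + x ℤ.- b ℤ.* + y ≡⟨ factor b (+ x) (+ y) ⟩
    b ℤ.* (+ x ℤ.- + y)     ≡⟨ cong (b ℤ.*_) (ℤP.[+m]-[+n]≡m⊖n x y) ⟩
    b ℤ.* (x ℤ.⊖ y)         ≡⟨ cong (b ℤ.*_) (ℤP.⊖-≥ y≤x) ⟩
    b ℤ.* + (x ∸ y)         ∎

module PartialSums (f : ℕ → ℕ) where

  sumUpTo : ℕ → ℕ
  sumUpTo N = sum (map f (upTo N))

  sumUpTo-suc : ∀ N → sumUpTo (suc N) ≡ sumUpTo N + f N
  sumUpTo-suc N = begin
    sum (map f (upTo (suc N)))      ≡⟨ cong (sum ∘ map f) (upTo-∷ʳ N) ⟨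
    sum (map f (upTo N ++ [ N ]))   ≡⟨ cong sum (map-++ f (upTo N) [ N ]) ⟩
    sum (map f (upTo N) ++ [ f N ]) ≡⟨ sum-++ (map f (upTo N)) [ f N ] ⟩
    sumUpTo N + (f N + 0)           ≡⟨ cong (λ k → sumUpTo N + k) (+-identityʳ (f N)) ⟩
    sumUpTo N + f N                 ∎
    where open ≡-Reasoning

  sumUpTo-mono-≤ : ∀ {m n} → m ≤ n → sumUpTo m ≤ sumUpTo n
  sumUpTo-mono-≤ {m} m≤n = go (≤⇒≤′ m≤n)
    where
    go : ∀ {n} → m ≤′ n → sumUpTo m ≤ sumUpTo n
    go ≤′-refl         = ≤-refl
    go (≤′-step {n} m≤′n) =
      ≤-trans (go m≤′n) (≤-trans (m≤m+n (sumUpTo n) (f n)) (≤-reflexive (sym (sumUpTo-suc n))))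

  sumUpTo-mono-< : (∀ n → 0 < f n) → ∀ {m n} → m < n → sumUpTo m < sumUpTo n
  sumUpTo-mono-< f>0 {m} {n} m<n = begin-strict
    sumUpTo m         <⟨ m<m+n (sumUpTo m) (f>0 m) ⟩
    sumUpTo m + f m   ≡⟨ sumUpTo-suc m ⟨
    sumUpTo (suc m)   ≤⟨ sumUpTo-mono-≤ m<n ⟩
    sumUpTo n         ∎
    where open ≤-Reasoning

  ∣-sumUpTo-∸ : ∀ {d N N′} → (∀ n → N ≤ n → d ∣ f n) → N ≤ N′ → d ∣ sumUpTo N′ ∸ sumUpTo N
  ∣-sumUpTo-∸ {d} {N} d∣f N≤N′ = go (≤⇒≤′ N≤N′)
    where
    go : ∀ {N′} → N ≤′ N′ → d ∣ sumUpTo N′ ∸ sumUpTo N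
    go ≤′-refl = subst (d ∣_) (sym (n∸n≡0 (sumUpTo N))) (d ∣0)
    go (≤′-step {N′} N≤′N′) = subst (d ∣_) (sym split) (∣m∣n⇒∣m+n (go N≤′N′) (d∣f N′ (≤′⇒≤ N≤′N′)))
      where
      split : sumUpTo (suc N′) ∸ sumUpTo N ≡ sumUpTo N′ ∸ sumUpTo N + f N′
      split = trans (cong (_∸ sumUpTo N) (sumUpTo-suc N′))
                    (+-∸-comm (f N′) (sumUpTo-mono-≤ (≤′⇒≤ N≤′N′)))

  module _ (f-mono : ∀ {m n} → m ≤ n → f m ≤ f n) where

    sumUpTo-≤-block : ∀ {a b} → a ≤ b → sumUpTo (suc b) ≤ sumUpTo a + (suc b ∸ a) * f b
    sumUpTo-≤-block {a} a≤b = go (≤⇒≤′ a≤b)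
      where
      go : ∀ {b} → a ≤′ b → sumUpTo (suc b) ≤ sumUpTo a + (suc b ∸ a) * f b
      go ≤′-refl = ≤-reflexive (begin-equality
        sumUpTo (suc a)                 ≡⟨ sumUpTo-suc a ⟩
        sumUpTo a + f a                 ≡⟨ cong (λ k → sumUpTo a + k) (*-identityˡ (f a)) ⟨
        sumUpTo a + 1 * f a             ≡⟨ cong (λ k → sumUpTo a + k * f a) (m+n∸n≡m 1 a) ⟨
        sumUpTo a + (suc a ∸ a) * f a   ∎)
        where open ≤-Reasoning
      go (≤′-step {b} a≤′b) = begin
        sumUpTo (suc (suc b))
          ≡⟨ sumUpTo-suc (suc b) ⟩
        sumUpTo (suc b) + f (suc b)
          ≤⟨ +-monoˡ-≤ (f (suc b)) (go a≤′b) ⟩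
        sumUpTo a + k * f b + f (suc b)
          ≤⟨ +-monoˡ-≤ (f (suc b)) (+-monoʳ-≤ (sumUpTo a) (*-monoʳ-≤ k (f-mono (n≤1+n b)))) ⟩
        sumUpTo a + k * f (suc b) + f (suc b)
          ≡⟨ regroup (sumUpTo a) k (f (suc b)) ⟩
        sumUpTo a + suc k * f (suc b)
          ≡⟨ cong (λ j → sumUpTo a + j * f (suc b)) (+-∸-assoc 1 (≤-trans (≤′⇒≤ a≤′b) (n≤1+n b))) ⟨
        sumUpTo a + (suc (suc b) ∸ a) * f (suc b)
          ∎
        where
        open ≤-Reasoning
        k = suc b ∸ a
        regroup : ∀ s k y → s + k * y + y ≡ s + suc k * y
        regroup = solve-∀

module GeometricGrowth (p : ℕ) (2≤p : 2 ≤ p) (f : ℕ → ℕ)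
  (f-mono : ∀ {m n} → m ≤ n → f m ≤ f n) (f-growth : ∀ n → p * f n ≤ f (p + n)) where

  open PartialSums f

  sumUpTo-≤-step : ∀ M → sumUpTo (suc M) ≤ 2 * (p * f M) →
                   sumUpTo (suc (p + M)) ≤ 2 * (p * f (p + M))
  sumUpTo-≤-step M ih = begin
    sumUpTo (suc (p + M))
      ≤⟨ sumUpTo-≤-block f-mono (+-monoˡ-≤ M 1≤p) ⟩
    sumUpTo (suc M) + (suc (p + M) ∸ suc M) * f (p + M)
      ≡⟨ cong (λ k → sumUpTo (suc M) + k * f (p + M)) (m+n∸n≡m p M) ⟩
    sumUpTo (suc M) + p * y
      ≤⟨ +-monoˡ-≤ (p * y) (≤-trans ih (*-monoʳ-≤ 2 (f-growth M))) ⟩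
    2 * y + p * y
      ≤⟨ +-monoˡ-≤ (p * y) (*-monoˡ-≤ y 2≤p) ⟩
    p * y + p * y
      ≡⟨ cong (λ k → p * y + k) (+-identityʳ (p * y)) ⟨
    2 * (p * y)
      ∎
    where
    open ≤-Reasoning
    y = f (p + M)
    1≤p : 1 ≤ p
    1≤p = ≤-trans (s≤s z≤n) 2≤p

  sumUpTo-suc-≤ : ∀ K → sumUpTo (suc K) ≤ 2 * (p * f K)
  sumUpTo-suc-≤ = <-rec _ bound
    where
    bound : ∀ K → (∀ {M} → M < K → sumUpTo (suc M) ≤ 2 * (p * f M)) →
            sumUpTo (suc K) ≤ 2 * (p * f K)
    bound K rec with K <? p
    ... | yes K<p = begin
      sumUpTo (suc K)   ≤⟨ sumUpTo-≤-block f-mono z≤n ⟩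
      suc K * f K       ≤⟨ *-monoˡ-≤ (f K) K<p ⟩
      p * f K           ≤⟨ m≤m+n (p * f K) (p * f K + 0) ⟩
      2 * (p * f K)     ∎
      where open ≤-Reasoning
    ... | no K≮p with m≤n⇒∃[o]m+o≡n (≮⇒≥ K≮p)
    ...   | M , refl = sumUpTo-≤-step M (rec (m<n+m M (≤-trans (s≤s z≤n) 2≤p)))

module Valuation (q : ℕ) where

  p : ℕ
  p = 2 + q

  pow-vpAux∣ : ∀ fuel x → p ^ vpAux fuel q x ∣ x
  pow-vpAux∣ zero x = 1∣ x
  pow-vpAux∣ (suc fuel) zero = 1∣ 0
  pow-vpAux∣ (suc fuel) (suc m) with p ∣? suc m
  ... | no _    = 1∣ suc m
  ... | yes p∣x = subst (p * p ^ vpAux fuel q (suc m / p) ∣_) (m*[n/m]≡n p∣x)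
                    (*-monoʳ-∣ p (pow-vpAux∣ fuel (suc m / p)))

  ∣⇒≤vpAux : ∀ fuel x k .{{_ : NonZero x}} → x ≤ fuel → p ^ k ∣ x → k ≤ vpAux fuel q x
  ∣⇒≤vpAux fuel x zero x≤fuel pᵏ∣x = z≤n
  ∣⇒≤vpAux (suc fuel) (suc m) (suc k) x≤fuel pᵏ∣x with p ∣? suc m
  ... | no p∤x  = contradiction (∣-trans (m∣m*n (p ^ k)) pᵏ∣x) p∤x
  ... | yes p∣x = s≤s (∣⇒≤vpAux fuel (suc m / p) k {{x/p≢0}} x/p≤fuel
                     (*-cancelˡ-∣ p (subst (p * p ^ k ∣_) (sym (m*[n/m]≡n p∣x)) pᵏ∣x)))
    where
    x/p≢0 : NonZero (suc m / p)
    x/p≢0 = m*n≢0⇒n≢0 p {{subst NonZero (sym (m*[n/m]≡n p∣x)) _}}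
    x/p≤fuel : suc m / p ≤ fuel
    x/p≤fuel = ≤-pred (≤-trans (m/n<m (suc m) p (s≤s (s≤s z≤n))) x≤fuel)

  v! : ℕ → ℕ
  v! n = vp p (n !)

  pow-v!∣ : ∀ n → p ^ v! n ∣ n !
  pow-v!∣ n = pow-vpAux∣ (n !) (n !)

  ∣!⇒≤v! : ∀ n k → p ^ k ∣ n ! → k ≤ v! n
  ∣!⇒≤v! n k = ∣⇒≤vpAux (n !) (n !) k {{n !≢0}} ≤-refl

  v!-mono : ∀ {m n} → m ≤ n → v! m ≤ v! n
  v!-mono {m} {n} m≤n = ∣!⇒≤v! n (v! m) (∣-trans (pow-v!∣ m) (m≤n⇒m!∣n! m≤n))

  -- p! · M! divides (p + M)!, and p divides p!.
  v!-+p : ∀ M → v! M < v! (p + M)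
  v!-+p M = ∣!⇒≤v! (p + M) (suc (v! M))
    (∣-trans (*-pres-∣ (m∣m*n {p} ((1 + q) !)) (pow-v!∣ M))
      (subst (λ k → p ! * k ! ∣ (p + M) !) (m+n∸m≡n p M) (k![n∸k]!∣n! (m≤m+n p M))))

  v!-suc : ∀ K m → p ^ m ∣ suc K → v! K + m ≤ v! (suc K)
  v!-suc K m pᵐ∣sucK = ∣!⇒≤v! (suc K) (v! K + m)
    (subst (_∣ suc K !) (trans (*-comm (p ^ m) (p ^ v! K)) (sym (^-distribˡ-+-* p (v! K) m)))
      (*-pres-∣ pᵐ∣sucK (pow-v!∣ K)))

module Irrationality (q : ℕ) where

  open Valuation q

  F : ℕ → ℕ
  F n = p ^ v! n

  F>0 : ∀ n → 0 < F n
  F>0 n = m^n>0 p (v! n)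

  F-mono : ∀ {m n} → m ≤ n → F m ≤ F n
  F-mono m≤n = ^-monoʳ-≤ p (v!-mono m≤n)

  F-growth : ∀ n → p * F n ≤ F (p + n)
  F-growth n = ^-monoʳ-≤ p (v!-+p n)

  open PartialSums F
  open GeometricGrowth p (s≤s (s≤s z≤n)) F F-mono F-growth

  threshold : ℤ → ℤ → ℕ
  threshold a b = 2 * (p * ℤ.∣ b ∣) + ℤ.∣ a ∣

  distance-< : ∀ a b K m → p ^ m ≡ suc K → threshold a b < suc K →
          ℤ.∣ b ℤ.* + sumUpTo (suc K) ℤ.- a ∣ < p ^ v! (suc K)
  distance-< a b K m pᵐ≡sucK C<sucK = begin-strict
    ℤ.∣ b ℤ.* + s ℤ.- a ∣           ≤⟨ ℤP.∣i-j∣≤∣i∣+∣j∣ (b ℤ.* + s) a ⟩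
    ℤ.∣ b ℤ.* + s ∣ + A             ≡⟨ cong (λ k → k + A) (ℤP.abs-* b (+ s)) ⟩
    B * s + A                       ≤⟨ +-monoˡ-≤ A (*-monoʳ-≤ B (sumUpTo-suc-≤ K)) ⟩
    B * (2 * (p * F K)) + A         <⟨ absorb (F>0 K) ⟩
    F K * suc (threshold a b)       ≤⟨ *-monoʳ-≤ (F K) (subst (_ <_) (sym pᵐ≡sucK) C<sucK) ⟩
    F K * p ^ m                     ≡⟨ ^-distribˡ-+-* p (v! K) m ⟨
    p ^ (v! K + m)                  ≤⟨ ^-monoʳ-≤ p (v!-suc K m (∣-reflexive pᵐ≡sucK)) ⟩
    p ^ v! (suc K)                  ∎
    where
    open ≤-Reasoning
    s = sumUpTo (suc K)
    A = ℤ.∣ a ∣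
    B = ℤ.∣ b ∣
    expand : ∀ P B A Y →
             suc Y * suc (2 * (P * B) + A) ≡ suc (B * (2 * (P * suc Y)) + A + (Y + Y * A))
    expand = solve-∀
    absorb : ∀ {Y} → 0 < Y → B * (2 * (p * Y)) + A < Y * suc (threshold a b)
    absorb {suc Y} _ = subst (B * (2 * (p * suc Y)) + A <_) (sym (expand p B A Y)) (s≤s (m≤m+n _ _))

  b*sumUpTo[pᵐ]≡a : ∀ a b → SeriesSumEq p a b → ∀ m → threshold a b < p ^ m →
                    b ℤ.* + sumUpTo (p ^ m) ≡ a
  b*sumUpTo[pᵐ]≡a a b bS≡a m C<pᵐ with p ^ m in pᵐ≡N
  b*sumUpTo[pᵐ]≡a a b bS≡a m () | zero
  ... | suc K = limit-attained {s = λ N → b ℤ.* + sumUpTo N} (v! (suc K)) bS≡a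
                  increment∣ (distance-< a b K m pᵐ≡N C<pᵐ)
    where
    increment∣ : ∀ N′ → suc K ≤ N′ →
                 + (p ^ v! (suc K)) ℤD.∣ (b ℤ.* + sumUpTo N′ ℤ.- b ℤ.* + sumUpTo (suc K))
    increment∣ N′ N≤N′ = ∣-*-increment b (sumUpTo-mono-≤ N≤N′)
      (∣-sumUpTo-∸ (λ n N≤n → ^-monoʳ-∣ p (v!-mono N≤n)) N≤N′)

  irrational : ∀ a b → b ≢ 0ℤ → ¬ SeriesSumEq p a b
  irrational a b b≢0 bS≡a =
    <-irrefl (ℤP.+-injective (ℤP.*-cancelˡ-≡ b _ _ {{ℤ.≢-nonZero b≢0}} same-products))
             (sumUpTo-mono-< F>0 pᶜ<pᶜ⁺¹)
    where
    C = threshold a b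
    pᶜ<pᶜ⁺¹ : p ^ C < p ^ suc C
    pᶜ<pᶜ⁺¹ = ^-monoʳ-< p (s≤s (s≤s z≤n)) (n<1+n C)
    C<pᶜ : C < p ^ C
    C<pᶜ = n<m^n (s≤s (s≤s z≤n)) C
    same-products : b ℤ.* + sumUpTo (p ^ C) ≡ b ℤ.* + sumUpTo (p ^ suc C)
    same-products = trans (b*sumUpTo[pᵐ]≡a a b bS≡a C C<pᶜ)
                          (sym (b*sumUpTo[pᵐ]≡a a b bS≡a (suc C) (<-trans C<pᶜ pᶜ<pᶜ⁺¹)))

corollary4 : ∀ (p : ℕ) → Prime p → ∀ (a b : ℤ) → b ≢ 0ℤ → ¬ SeriesSumEq p a b
-- Primality is used only through p ≥ 2.
corollary4 (suc (suc q)) _ = Irrationality.irrational q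
corollary4 0 p-prime with () ← nonTrivial⇒n>1 0 {{prime⇒nonTrivial p-prime}}
corollary4 1 p-prime with s≤s () ← nonTrivial⇒n>1 1 {{prime⇒nonTrivial p-prime}}
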